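{- Let $\mathcal{R}$ be a non-duplicating LR-separated CTRS and $\Lambda$ a finite multiset of equations. (i) If $\Lambda\Vdash_{\mathcal{R}}u\sim_kv$, then $u\underset{\Delta}{\sim}v$ for some $\Delta=\Lambda'\sqcup\{\bullet^k\}$ with $\Lambda'\sqsubseteq\Lambda$. (ii) If $\Lambda\Vdash_{\mathcal{R}}u\to_kv$, then $u\underset{\Delta}{\sim\!\triangleright}v$ for some $\Delta=\Lambda'\sqcup\{\bullet^{k-1}\}$ with $\Lambda'\sqsubseteq\Lambda$. (iii) If $\Lambda\Vdash_{\mathcal{R}}\langle u_1,\dots,u_n\rangle\sim_k\langle v_1,\dots,v_n\rangle$, then there are $\Delta_1,\dots,\Delta_n$ with $u_j\underset{\Delta_j}{\sim}v_j$ for $j=1,\dots,n$ and $\bigsqcup_j\Delta_j=\Lambda'\sqcup\{\bullet^k\}$ for some $\Lambda'\sqsubseteq\Lambda$.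
   Context: An LR-separated conditional rule is $l\to r\Leftarrow x_1\approx y_1,\dots,x_n\approx y_n$ with $l$ linear non-variable, $\mathcal{V}(l)=\{x_i\}$, $\mathcal{V}(r)\subseteq\{y_i\}$, $\{x_i\}\cap\{y_i\}=\emptyset$, $x_i$ pairwise distinct; non-duplicating if each $y\in\mathcal{V}(r)$ occurs in $r$ at most as often as in $y_1,\dots,y_n$. An LR-separated CTRS is a finite set of such rules. $\sqcup$ is multiset union, $\sqsubseteq$ sub-multiset, $\bullet$ a fresh constant and $\{\bullet^k\}$ the multiset of $k$ copies of $\bullet$. Judgements $\Gamma\Vdash_{\mathcal{R}}u\sim_nv$, $\Gamma\Vdash_{\mathcal{R}}u\to_nv$, $\Gamma\Vdash_{\mathcal{R}}\langle\vec u\rangle\sim_n\langle\vec v\rangle$ ($\Gamma$ a finite multiset of equations, $n\in\mathbb{N}$) are the least closed under: $\Gamma\sqcup\{u\approx v\}\Vdash u\sim_0v$; $\Gamma\Vdash t\sim_0t$; from $\Gamma\Vdash t\sim_is$ infer $\Gamma\Vdash s\sim_it$; from $\Gamma\Vdash s\sim_it$ and $\Sigma\Vdash t\sim_ju$ infer $\Gamma\sqcup\Sigma\Vdash s\sim_{i+j}u$; from $\Gamma\Vdash s\sim_it$ infer $\Gamma\Vdash C[s]\sim_iC[t]$; from $\Gamma_k\Vdash u_k\sim_{i_k}v_k$ ($k=1..m$) infer $\bigsqcup_k\Gamma_k\Vdash\langle u_1..u_m\rangle\sim_{\sum i_k}\langle v_1..v_m\rangle$; from $\Gamma\Vdash s\to_it$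 infer $\Gamma\Vdash s\sim_it$; for $l\to r\Leftarrow u_1\approx v_1,..,u_m\approx v_m\in\mathcal{R}$, substitution $\sigma$, context $C$: from $\Gamma\Vdash\langle u_1\sigma..u_m\sigma\rangle\sim_i\langle v_1\sigma..v_m\sigma\rangle$ infer $\Gamma\Vdash C[l\sigma]\to_{i+1}C[r\sigma]$. Relations $t\underset{\Gamma}{\sim}s$ and $t\underset{\Gamma}{\sim\!\triangleright}s$, for $\Gamma$ a finite multiset of equations and copies of $\bullet$, are the least closed under: $t\underset{\{t\approx s\}}{\sim}s$; $t\underset{\emptyset}{\sim}t$; if $t\underset{\Gamma}{\sim}s$ then $s\underset{\Gamma}{\sim}t$; if $t\underset{\Gamma}{\sim}r$ and $r\underset{\Gamma'}{\sim}s$ then $t\underset{\Gamma\sqcup\Gamma'}{\sim}s$; if $t\underset{\Gamma}{\sim}s$ then $C[t]\underset{\Gamma}{\sim}C[s]$; if $l\to r\Leftarrow x_1\approx y_1,..,x_n\approx y_n\in\mathcal{R}$ and $x_i\theta\underset{\Gamma_i}{\sim}y_i\theta$ for $i=1..n$ then $C[l\theta]\underset{\Gamma_1\sqcup\cdots\sqcup\Gamma_n}{\sim\!\triangleright}C[r\theta]$; if $t\underset{\Gamma}{\sim\!\triangleright}s$ then $t\underset{\Gamma\sqcup\{\bullet\}}{\sim}s$. -}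

module Defs where

open import Level using (0ℓ)
open import Data.Nat using (ℕ; zero; suc; _+_; _≤_; _≟_)
open import Data.Fin using (Fin)
open import Data.Vec using (Vec; []; _∷_; _[_]≔_)
open import Data.List using (List; []; _∷_; _++_; map; concat; length; filter; replicate)
open import Data.List.Membership.Propositional using (_∈_)
open import Data.List.Relation.Unary.Unique.Propositional using (Unique)
open import Data.List.Relation.Binary.Permutation.Propositional using (_↭_)
open import Data.Product using (_×_; _,_; Σ; ∃; proj₁; proj₂)
open import Relation.Binary.PropositionalEquality using (_≡_)
open import Relation.Nullary using (¬_)
open import Data.Empty using (⊥)

record Signature : Set₁ where
  field
    Sym   : Set
    arity : Sym → ℕ
open Signature public

Var : Set
Var = ℕ

variable
  S : Signature

data Term (S : Signature) : Set where
  var : Var → Term S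
  fun : (f : Sym S) → Vec (Term S) (arity S f) → Term S

mutual
  vars : Term S → List Var
  vars (var x)    = x ∷ []
  vars (fun f ts) = varsV ts

  varsV : ∀ {n} → Vec (Term S) n → List Var
  varsV []       = []
  varsV (t ∷ ts) = vars t ++ varsV ts

Subst : Signature → Set
Subst S = Var → Term S

mutual
  _·_ : Term S → Subst S → Term S
  var x    · σ = σ x
  fun f ts · σ = fun f (ts ·V σ)

  _·V_ : ∀ {n} → Vec (Term S) n → Subst S → Vec (Term S) n
  []       ·V σ = []
  (t ∷ ts) ·V σ = (t · σ) ∷ (ts ·V σ)

-- one-hole contexts: cfun f i ts C is f(ts with the i-th argument replaced by C)
data Ctx (S : Signature) : Set where
  hole : Ctx S
  cfun : (f : Sym S) → Fin (arity S f) → Vec (Term S) (arity S f) → Ctx S → Ctx S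

_⟦_⟧ : Ctx S → Term S → Term S
hole          ⟦ t ⟧ = t
cfun f i ts C ⟦ t ⟧ = fun f (ts [ i ]≔ (C ⟦ t ⟧))

record Rule (S : Signature) : Set where
  constructor _⟶_⇐_
  field
    lhs   : Term S
    rhs   : Term S
    conds : List (Var × Var)
open Rule public

xs-of ys-of : Rule S → List Var
xs-of ρ = map proj₁ (conds ρ)
ys-of ρ = map proj₂ (conds ρ)

occ : Var → List Var → ℕ
occ y zs = length (filter (y ≟_) zs)

record LRSeparated (ρ : Rule S) : Set where
  field
    lhs-nonvar   : ∀ x → ¬ (lhs ρ ≡ var x)
    lhs-linear   : Unique (vars (lhs ρ))
    lhs-vars     : ∀ x → (x ∈ vars (lhs ρ) → x ∈ xs-of ρ) × (x ∈ xs-of ρ → x ∈ vars (lhs ρ))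
    rhs-vars     : ∀ y → y ∈ vars (rhs ρ) → y ∈ ys-of ρ
    disjoint     : ∀ x → x ∈ xs-of ρ → x ∈ ys-of ρ → ⊥
    xs-distinct  : Unique (xs-of ρ)

NonDuplicating : Rule S → Set
NonDuplicating ρ = ∀ y → y ∈ vars (rhs ρ) → occ y (vars (rhs ρ)) ≤ occ y (ys-of ρ)

CTRS : Signature → Set
CTRS S = List (Rule S)

-- Finite multisets are represented by lists, compared up to permutation (_↭_).

_⊑_ : {A : Set} → List A → List A → Set
xs ⊑ ys = ∃ λ zs → (xs ++ zs) ↭ ys

Eqn : Signature → Set
Eqn S = Term S × Term S

-- elements of the multisets Γ in t ∼_Γ s : equations and copies of •
data Elem (S : Signature) : Set where
  eqn    : Term S → Term S → Elem S
  bullet : Elem S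

eqns : List (Eqn S) → List (Elem S)
eqns = map (λ e → eqn (proj₁ e) (proj₂ e))

bullets : ℕ → List (Elem S)
bullets k = replicate k bullet

condL condR : Rule S → Subst S → List (Term S)
condL ρ σ = map (λ c → var (proj₁ c) · σ) (conds ρ)
condR ρ σ = map (λ c → var (proj₂ c) · σ) (conds ρ)

mutual
  data _∣_⊩_∼[_]_ (R : CTRS S) : List (Eqn S) → Term S → ℕ → Term S → Set where
    ax    : ∀ {Γ u v} → R ∣ ((u , v) ∷ Γ) ⊩ u ∼[ 0 ] v
    rfl   : ∀ {Γ t} → R ∣ Γ ⊩ t ∼[ 0 ] t
    sym   : ∀ {Γ s t i} → R ∣ Γ ⊩ t ∼[ i ] s → R ∣ Γ ⊩ s ∼[ i ] t
    trans : ∀ {Γ Σ s t u i j} → R ∣ Γ ⊩ s ∼[ i ] t → R ∣ Σ ⊩ t ∼[ j ] u →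
            R ∣ (Γ ++ Σ) ⊩ s ∼[ i + j ] u
    ctx   : ∀ {Γ s t i} (C : Ctx S) → R ∣ Γ ⊩ s ∼[ i ] t → R ∣ Γ ⊩ (C ⟦ s ⟧) ∼[ i ] (C ⟦ t ⟧)
    step  : ∀ {Γ s t i} → R ∣ Γ ⊩ s ⟶[ i ] t → R ∣ Γ ⊩ s ∼[ i ] t

  data _∣_⊩_⟶[_]_ (R : CTRS S) : List (Eqn S) → Term S → ℕ → Term S → Set where
    rule : ∀ {Γ i} (ρ : Rule S) → ρ ∈ R → (σ : Subst S) (C : Ctx S) →
           R ∣ Γ ⊩⟨ condL ρ σ ⟩∼[ i ]⟨ condR ρ σ ⟩ →
           R ∣ Γ ⊩ (C ⟦ lhs ρ · σ ⟧) ⟶[ suc i ] (C ⟦ rhs ρ · σ ⟧)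

  -- the m-ary tuple rule, unfolded into nil/cons
  data _∣_⊩⟨_⟩∼[_]⟨_⟩ (R : CTRS S) : List (Eqn S) → List (Term S) → ℕ → List (Term S) → Set where
    tnil  : R ∣ [] ⊩⟨ [] ⟩∼[ 0 ]⟨ [] ⟩
    tcons : ∀ {Γ Σ u v us vs i j} → R ∣ Γ ⊩ u ∼[ i ] v → R ∣ Σ ⊩⟨ us ⟩∼[ j ]⟨ vs ⟩ →
            R ∣ (Γ ++ Σ) ⊩⟨ u ∷ us ⟩∼[ i + j ]⟨ v ∷ vs ⟩

mutual
  data _∣_∼⟨_⟩_ (R : CTRS S) : Term S → List (Elem S) → Term S → Set where
    base   : ∀ {t s} → R ∣ t ∼⟨ eqn t s ∷ [] ⟩ s
    rfl    : ∀ {t} → R ∣ t ∼⟨ [] ⟩ t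
    sym    : ∀ {t s Γ} → R ∣ t ∼⟨ Γ ⟩ s → R ∣ s ∼⟨ Γ ⟩ t
    trans  : ∀ {t r s Γ Γ'} → R ∣ t ∼⟨ Γ ⟩ r → R ∣ r ∼⟨ Γ' ⟩ s → R ∣ t ∼⟨ Γ ++ Γ' ⟩ s
    ctx    : ∀ {t s Γ} (C : Ctx S) → R ∣ t ∼⟨ Γ ⟩ s → R ∣ (C ⟦ t ⟧) ∼⟨ Γ ⟩ (C ⟦ s ⟧)
    weaken : ∀ {t s Γ} → R ∣ t ∼▷⟨ Γ ⟩ s → R ∣ t ∼⟨ Γ ++ (bullet ∷ []) ⟩ s

  data _∣_∼▷⟨_⟩_ (R : CTRS S) : Term S → List (Elem S) → Term S → Set where
    rule : ∀ (ρ : Rule S) → ρ ∈ R → (θ : Subst S) (C : Ctx S) (Γs : List (List (Elem S))) →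
           AllSim R Γs (condL ρ θ) (condR ρ θ) →
           R ∣ (C ⟦ lhs ρ · θ ⟧) ∼▷⟨ concat Γs ⟩ (C ⟦ rhs ρ · θ ⟧)

  data AllSim (R : CTRS S) : List (List (Elem S)) → List (Term S) → List (Term S) → Set where
    snil  : AllSim R [] [] []
    scons : ∀ {Γ Γs u us v vs} → R ∣ u ∼⟨ Γ ⟩ v → AllSim R Γs us vs →
            AllSim R (Γ ∷ Γs) (u ∷ us) (v ∷ vs)

module Submission where

open import Defs
open import Algebra.Properties.CommutativeSemigroup using (interchange)
open import Algebra.Bundles using (CommutativeMonoid)
open import Data.Nat using (ℕ; zero; suc; _+_; _∸_)
open import Data.List using (List; []; _∷_; _++_; [_]; concat)
open import Data.List.Membership.Propositional using (_∈_)
open import Data.List.Properties using (map-++; ++-assoc)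
open import Data.List.Relation.Binary.Permutation.Propositional
  using (_↭_; ↭-refl; ↭-trans; ↭-reflexive; module PermutationReasoning)
open import Data.List.Relation.Binary.Permutation.Propositional.Properties
  using (++⁺; ++⁺ˡ; ∷↭∷ʳ; ++-commutativeMonoid)
open import Data.Product using (_×_; ∃-syntax; _,_)
open import Function using (id)
open import Relation.Binary.PropositionalEquality using (_≡_; refl; cong; cong₂)

-- Each derivation is translated rule by rule: an axiom Γ ⊔ {u ≈ v} ⊩ u ∼₀ v
-- becomes the base step charged to u ≈ v, the binary rules add up their
-- charges, and each application of a conditional rule is paid for by one •.

++-interchange : {A : Set} (a b c d : List A) → (a ++ b) ++ (c ++ d) ↭ (a ++ c) ++ (b ++ d)
++-interchange = interchange (CommutativeMonoid.commutativeSemigroup ++-commutativeMonoid)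

[]⊑ : {A : Set} {xs : List A} → [] ⊑ xs
[]⊑ {xs = xs} = xs , ↭-refl

⊑-++⁺ : {A : Set} {xs xs′ ys ys′ : List A} → xs ⊑ xs′ → ys ⊑ ys′ → (xs ++ ys) ⊑ (xs′ ++ ys′)
⊑-++⁺ {xs = xs} {ys = ys} (zs , p) (ws , q) = zs ++ ws , ↭-trans (++-interchange xs ys zs ws) (++⁺ p q)

module _ {S : Signature} where

  bullets-+ : ∀ i j → bullets {S} (i + j) ≡ bullets i ++ bullets j
  bullets-+ zero    j = refl
  bullets-+ (suc i) j = cong (bullet ∷_) (bullets-+ i j)

  ↭-charge-++ : {Δ Δ′ : List (Elem S)} (Λ Λ′ : List (Eqn S)) (i j : ℕ) →
    Δ ↭ eqns Λ ++ bullets i → Δ′ ↭ eqns Λ′ ++ bullets j →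
    Δ ++ Δ′ ↭ eqns (Λ ++ Λ′) ++ bullets (i + j)
  ↭-charge-++ {Δ} {Δ′} Λ Λ′ i j p q = begin
    Δ ++ Δ′                                          ↭⟨ ++⁺ p q ⟩
    (eqns Λ ++ bullets i) ++ (eqns Λ′ ++ bullets j)  ↭⟨ ++-interchange (eqns Λ) _ _ _ ⟩
    (eqns Λ ++ eqns Λ′) ++ (bullets i ++ bullets j)  ≡⟨ cong₂ _++_ (map-++ _ Λ Λ′) (bullets-+ i j) ⟨
    eqns (Λ ++ Λ′) ++ bullets (i + j)                ∎
    where open PermutationReasoning

  ↭-charge-bullet : {Δ : List (Elem S)} (E : List (Elem S)) (i : ℕ) →
    Δ ↭ E ++ bullets i → Δ ++ [ bullet ] ↭ E ++ bullets (suc i)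
  ↭-charge-bullet {Δ} E i p = begin
    Δ ++ [ bullet ]                ↭⟨ ++⁺ p ↭-refl ⟩
    (E ++ bullets i) ++ [ bullet ] ≡⟨ ++-assoc E (bullets i) [ bullet ] ⟩
    E ++ bullets i ++ [ bullet ]   ↭⟨ ++⁺ˡ E (∷↭∷ʳ bullet (bullets i)) ⟨
    E ++ bullets (suc i)           ∎
    where open PermutationReasoning

  -- ∣_∣ is the identity for a single Δ and concat for a family Δ₁ … Δₙ.
  WithinBudget : {A : Set} → (A → List (Elem S)) → List (Eqn S) → ℕ → (A → Set) → Set
  WithinBudget ∣_∣ Λ k P = ∃[ Λ′ ] ∃[ a ] (Λ′ ⊑ Λ × ∣ a ∣ ↭ eqns Λ′ ++ bullets k × P a)

  module _ {A B : Set} {∣_∣ : A → List (Elem S)} {∥_∥ : B → List (Elem S)}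
           {P : A → Set} {Q : B → Set} where

    withinBudget-map : ∀ {Λ k} (f : A → B) → (∀ a → ∥ f a ∥ ≡ ∣ a ∣) →
      (∀ {a} → P a → Q (f a)) → WithinBudget ∣_∣ Λ k P → WithinBudget ∥_∥ Λ k Q
    withinBudget-map f ∥f∥≡ g (Λ′ , a , s , p , Pa) =
      Λ′ , f a , s , ↭-trans (↭-reflexive (∥f∥≡ a)) p , g Pa

    withinBudget-++ : ∀ {C : Set} {∣_∣′ : C → List (Elem S)} {T : C → Set}
      {Λ₁ Λ₂ i j} (f : A → B → C) → (∀ a b → ∣ f a b ∣′ ≡ ∣ a ∣ ++ ∥ b ∥) →
      (∀ {a b} → P a → Q b → T (f a b)) →
      WithinBudget ∣_∣ Λ₁ i P → WithinBudget ∥_∥ Λ₂ j Q → WithinBudget ∣_∣′ (Λ₁ ++ Λ₂) (i + j) T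
    withinBudget-++ {i = i} {j} f ∣f∣≡ g (Λ₁′ , a , s₁ , p₁ , Pa) (Λ₂′ , b , s₂ , p₂ , Qb) =
      Λ₁′ ++ Λ₂′ , f a b , ⊑-++⁺ s₁ s₂ ,
      ↭-trans (↭-reflexive (∣f∣≡ a b)) (↭-charge-++ Λ₁′ Λ₂′ i j p₁ p₂) , g Pa Qb

  withinBudget-bullet : ∀ {Λ k} {P Q : List (Elem S) → Set} →
    (∀ {Δ} → P Δ → Q (Δ ++ [ bullet ])) → WithinBudget id Λ k P → WithinBudget id Λ (suc k) Q
  withinBudget-bullet g (Λ′ , Δ , s , p , PΔ) =
    Λ′ , Δ ++ [ bullet ] , s , ↭-charge-bullet (eqns Λ′) _ p , g PΔ

  module _ (R : CTRS S) where

    mutual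
      ∼⇒∼⟨⟩ : ∀ {Λ u v k} → R ∣ Λ ⊩ u ∼[ k ] v → WithinBudget id Λ k (λ Δ → R ∣ u ∼⟨ Δ ⟩ v)
      ∼⇒∼⟨⟩ (ax {Γ} {u} {v}) = [ u , v ] , [ eqn u v ] , (Γ , ↭-refl) , ↭-refl , base
      ∼⇒∼⟨⟩ rfl              = [] , [] , []⊑ , ↭-refl , rfl
      ∼⇒∼⟨⟩ (sym d)          = withinBudget-map id (λ _ → refl) sym (∼⇒∼⟨⟩ d)
      ∼⇒∼⟨⟩ (trans d e)      = withinBudget-++ _++_ (λ _ _ → refl) trans (∼⇒∼⟨⟩ d) (∼⇒∼⟨⟩ e)
      ∼⇒∼⟨⟩ (ctx C d)        = withinBudget-map id (λ _ → refl) (ctx C) (∼⇒∼⟨⟩ d)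
      ∼⇒∼⟨⟩ (step d@(rule _ _ _ _ _)) = withinBudget-bullet weaken (⟶⇒∼▷ d)

      ⟶⇒∼▷ : ∀ {Λ u v k} → R ∣ Λ ⊩ u ⟶[ k ] v → WithinBudget id Λ (k ∸ 1) (λ Δ → R ∣ u ∼▷⟨ Δ ⟩ v)
      ⟶⇒∼▷ (rule ρ ρ∈R σ C d) =
        withinBudget-map concat (λ _ → refl) (rule ρ ρ∈R σ C _) (⟨⟩∼⇒AllSim d)

      ⟨⟩∼⇒AllSim : ∀ {Λ us vs k} → R ∣ Λ ⊩⟨ us ⟩∼[ k ]⟨ vs ⟩ →
        WithinBudget concat Λ k (λ Δs → AllSim R Δs us vs)
      ⟨⟩∼⇒AllSim tnil        = [] , [] , []⊑ , ↭-refl , snil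
      ⟨⟩∼⇒AllSim (tcons d e) = withinBudget-++ _∷_ (λ _ _ → refl) scons (∼⇒∼⟨⟩ d) (⟨⟩∼⇒AllSim e)

lemma7 : (S : Signature) (R : CTRS S) →
    (∀ ρ → ρ ∈ R → LRSeparated ρ × NonDuplicating ρ) →
    (Λ : List (Eqn S)) →
    (∀ {u v k} → R ∣ Λ ⊩ u ∼[ k ] v →
       ∃[ Λ' ] ∃[ Δ ] (Λ' ⊑ Λ × Δ ↭ (eqns Λ' ++ bullets k) × R ∣ u ∼⟨ Δ ⟩ v))
    × (∀ {u v k} → R ∣ Λ ⊩ u ⟶[ k ] v →
       ∃[ Λ' ] ∃[ Δ ] (Λ' ⊑ Λ × Δ ↭ (eqns Λ' ++ bullets (k ∸ 1)) × R ∣ u ∼▷⟨ Δ ⟩ v))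
    × (∀ {us vs k} → R ∣ Λ ⊩⟨ us ⟩∼[ k ]⟨ vs ⟩ →
       ∃[ Λ' ] ∃[ Δs ] (Λ' ⊑ Λ × concat Δs ↭ (eqns Λ' ++ bullets k) × AllSim R Δs us vs))
lemma7 S R _ Λ = ∼⇒∼⟨⟩ R , ⟶⇒∼▷ R , ⟨⟩∼⇒AllSim R
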